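{- Let $G_1$ and $G_2$ be looped simple graphs and $v\in V(G_1)$. The following are equivalent: (1) up to isomorphism, $G_2$ is obtained from $G_1$ by complementing the loop status of $v$; (2) there is a compatible isomorphism $\beta:M(IAS(G_1))\to M(IAS(G_2))$ with $f_\beta(v)=(\chi\psi)$ and $f_\beta(w)=1$ for all $w\neq v$.
   Context: A looped simple graph is a finite graph in which each vertex may carry at most one loop and distinct non-loop edges join distinct pairs of vertices. $A(G)$ is its adjacency matrix over $GF(2)$ (diagonal entry $1$ iff looped). $M(IAS(G))$ is the binary matroid represented by the columns of $(I\mid A(G)\mid I+A(G))$ over $GF(2)$; its ground set $W(G)$ consists of columns $v_\phi,v_\chi,v_\psi$, the columns of $v$ in $I$, $A(G)$, $I+A(G)$. $S_3$ is the permutation group of $\{\phi,\chi,\psi\}$ with identity $1$ and standard cycle notation. A compatible isomorphism $\beta$ is a matroid isomorphism mapping each cell $\{v_\phi,v_\chi,v_\psi\}$ onto some cell $\{w_\phi,w_\chi,w_\psi\}$; it induces a bijection $\beta:V(G_1)\to V(G_2)$ and $f_\beta:V(G_1)\to S_3$ with $\beta(v_\iota)=\beta(v)_{f_\beta(v)(\iota)}$. -}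

module Defs where

open import Data.Bool using (Bool; true; false; _xor_; _∧_; if_then_else_)
open import Data.Nat using (ℕ; zero; suc)
open import Data.Fin using (Fin; zero; suc; _≟_)
open import Data.Product using (_×_; _,_; Σ; ∃)
open import Relation.Binary.PropositionalEquality using (_≡_)
open import Relation.Nullary using (does)
open import Function.Bundles using (_↔_; _⇔_; Inverse)

-- A looped simple graph on vertex set Fin n: symmetric adjacency matrix over
-- GF(2) = Bool; diagonal entry true iff the vertex is looped.
record LoopedSimpleGraph (n : ℕ) : Set where
  field
    adj : Fin n → Fin n → Bool
    sym : ∀ u w → adj u w ≡ adj w u
open LoopedSimpleGraph public

data Tag : Set where
  φ χ ψ : Tag

swapχψ : Tag → Tag
swapχψ φ = φ
swapχψ χ = ψ
swapχψ ψ = χ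

-- Ground set W(G) of M(IAS(G)): v_ι = (v , ι).
W : ℕ → Set
W n = Fin n × Tag

δ : ∀ {n} → Fin n → Fin n → Bool
δ u w = does (u ≟ w)

-- Column of the matrix (I | A(G) | I + A(G)) belonging to v_ι, as a vector in GF(2)^n.
column : ∀ {n} → LoopedSimpleGraph n → W n → Fin n → Bool
column G (v , φ) u = δ u v
column G (v , χ) u = adj G u v
column G (v , ψ) u = δ u v xor adj G u v

⊕Σ : ∀ {k} → (Fin k → Bool) → Bool
⊕Σ {zero} f = false
⊕Σ {suc k} f = f zero xor ⊕Σ (λ i → f (suc i))

⊕Tag : (Tag → Bool) → Bool
⊕Tag f = f φ xor (f χ xor f ψ)

lincomb : ∀ {n} → LoopedSimpleGraph n → (W n → Bool) → Fin n → Bool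
lincomb G c u = ⊕Σ (λ v → ⊕Tag (λ ι → c (v , ι) ∧ column G (v , ι) u))

Independent : ∀ {n} → LoopedSimpleGraph n → (W n → Bool) → Set
Independent {n} G S =
  (c : W n → Bool) → (∀ x → c x ≡ true → S x ≡ true) →
  (∀ u → lincomb G c u ≡ false) → ∀ x → c x ≡ false

IsMatroidIso : ∀ {n m} → LoopedSimpleGraph n → LoopedSimpleGraph m → (W n ↔ W m) → Set
IsMatroidIso {n} G₁ G₂ β =
  (S : W n → Bool) → Independent G₁ S ⇔ Independent G₂ (λ y → S (Inverse.from β y))

IsGraphIso : ∀ {n m} → LoopedSimpleGraph n → LoopedSimpleGraph m → (Fin n ↔ Fin m) → Set
IsGraphIso {n} G₁ G₂ σ =
  ∀ (u w : Fin n) → adj G₂ (Inverse.to σ u) (Inverse.to σ w) ≡ adj G₁ u w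

toggleLoop : ∀ {n} → LoopedSimpleGraph n → Fin n → LoopedSimpleGraph n
toggleLoop G v = record
  { adj = λ u w → if does (u ≟ v) ∧ does (w ≟ v) then (adj G u w xor true) else adj G u w
  ; sym = symT }
  where
  open import Data.Bool.Properties using (∧-comm)
  open import Relation.Binary.PropositionalEquality using (cong₂)
  symT : ∀ u w → _ ≡ _
  symT u w = cong₂ (λ b a → if b then (a xor true) else a)
                   (∧-comm (does (u ≟ v)) (does (w ≟ v))) (sym G u w)

fSwapAt : ∀ {n} → Fin n → Fin n → Tag → Tag
fSwapAt v w ι = if does (w ≟ v) then swapχψ ι else ι

InducesCompatible : ∀ {n m} → (W n ↔ W m) → (Fin n → Fin m) → (Fin n → Tag → Tag) → Set
InducesCompatible {n} β σ f = ∀ (w : Fin n) (ι : Tag) → Inverse.to β (w , ι) ≡ (σ w , f w ι)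

-- The φ-columns of (I | A | I + A) form the standard basis, and a matroid
-- isomorphism that maps φ-columns to φ-columns preserves every column in
-- basis coordinates: column x has a 1 in coordinate u iff u_φ lies in the
-- fundamental circuit of x, and fundamental circuits are matroid data.
-- Complementing the loop at v exchanges exactly the two columns v_χ = A e_v
-- and v_ψ = (I + A) e_v, so both conditions in the theorem say that σ and the
-- transposition (χψ) at v carry the columns of G₁ to the columns of G₂; and
-- any such column-preserving cell map is a matroid isomorphism.
module Submission where

open import Defs hiding (sym)
open import Data.Nat using (ℕ; zero; suc)
open import Data.Fin using (Fin; zero; suc; _≟_)
open import Data.Fin.Properties using (suc-injective)
open import Data.Product using (Σ; _×_; _,_; proj₁; proj₂)
open import Data.Product.Properties using (≡-dec)
open import Data.Bool using (Bool; true; false; _xor_; _∧_; if_then_else_)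
open import Data.Bool.Properties
  using (⇔→≡; xor-comm; xor-assoc; xor-same; xor-identityʳ; ∧-identityʳ; ∧-zeroʳ; xor-∧-commutativeRing)
open import Data.Empty using (⊥-elim)
open import Function.Base using (_∘_)
open import Function.Bundles using (_↔_; _⇔_; Inverse; Injection; Equivalence; mk↔ₛ′; mk⇔)
open import Function.Properties.Inverse using (↔-sym; ↔⇒↣)
open import Function.Definitions using (Injective)
open import Relation.Binary.Definitions using (DecidableEquality)
open import Relation.Binary.PropositionalEquality
open import Relation.Nullary using (¬_; yes; no; does)
open import Relation.Nullary.Decidable using (dec-true; dec-false)
open import Algebra.Bundles using (CommutativeRing)
import Algebra.Properties.CommutativeMonoid.Sum as CommutativeMonoidSum

open Inverse using (to; from; strictlyInverseˡ; strictlyInverseʳ)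

private
  module GF2 = CommutativeMonoidSum (CommutativeRing.+-commutativeMonoid xor-∧-commutativeRing)

⊕Σ≡sum : ∀ {k} (f : Fin k → Bool) → ⊕Σ f ≡ GF2.sum f
⊕Σ≡sum {zero} f = refl
⊕Σ≡sum {suc k} f = cong (f zero xor_) (⊕Σ≡sum (f ∘ suc))

⊕Σ-cong : ∀ {k} {f g : Fin k → Bool} → (∀ i → f i ≡ g i) → ⊕Σ f ≡ ⊕Σ g
⊕Σ-cong {zero} f≗g = refl
⊕Σ-cong {suc k} f≗g = cong₂ _xor_ (f≗g zero) (⊕Σ-cong (f≗g ∘ suc))

⊕Σ-permute : ∀ {n m} (σ : Fin n ↔ Fin m) (f : Fin m → Bool) → ⊕Σ f ≡ ⊕Σ (f ∘ to σ)
⊕Σ-permute σ f = trans (⊕Σ≡sum f) (trans (GF2.sum-permute f σ) (sym (⊕Σ≡sum (f ∘ to σ))))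

⊕Σ-xor : ∀ {k} (f g : Fin k → Bool) → ⊕Σ (λ i → f i xor g i) ≡ ⊕Σ f xor ⊕Σ g
⊕Σ-xor f g =
  trans (⊕Σ≡sum (λ i → f i xor g i)) (trans (GF2.∑-distrib-+ f g) (sym (cong₂ _xor_ (⊕Σ≡sum f) (⊕Σ≡sum g))))

⊕Σ-zero : ∀ {k} (f : Fin k → Bool) → (∀ i → f i ≡ false) → ⊕Σ f ≡ false
⊕Σ-zero {zero} f f≗0 = refl
⊕Σ-zero {suc k} f f≗0 rewrite f≗0 zero = ⊕Σ-zero (f ∘ suc) (f≗0 ∘ suc)

⊕Σ-single : ∀ {k} (f : Fin k → Bool) (j : Fin k) → (∀ i → ¬ i ≡ j → f i ≡ false) → ⊕Σ f ≡ f j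
⊕Σ-single f zero off =
  trans (cong (f zero xor_) (⊕Σ-zero (f ∘ suc) (λ i → off (suc i) λ ()))) (xor-identityʳ (f zero))
⊕Σ-single f (suc j) off rewrite off zero (λ ()) =
  ⊕Σ-single (f ∘ suc) j (λ i i≢j → off (suc i) (i≢j ∘ suc-injective))

true≢false : ¬ true ≡ false
true≢false ()

xor-cancelˡ : ∀ a b → a xor (a xor b) ≡ b
xor-cancelˡ a b = trans (sym (xor-assoc a a b)) (cong (_xor b) (xor-same a))

swapIf : Bool → Tag → Tag
swapIf b ι = if b then swapχψ ι else ι

swapIf-φ : ∀ b → swapIf b φ ≡ φ
swapIf-φ false = refl
swapIf-φ true = refl

fSwapAt-φ : ∀ {n} (v w : Fin n) → fSwapAt v w φ ≡ φ
fSwapAt-φ v w = swapIf-φ (does (w ≟ v))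

swapIf-involutive : ∀ b ι → swapIf b (swapIf b ι) ≡ ι
swapIf-involutive false ι = refl
swapIf-involutive true φ = refl
swapIf-involutive true χ = refl
swapIf-involutive true ψ = refl

⊕Tag-swapIf : ∀ b (g : Tag → Bool) → ⊕Tag (g ∘ swapIf b) ≡ ⊕Tag g
⊕Tag-swapIf false g = refl
⊕Tag-swapIf true g = cong (g φ xor_) (xor-comm (g ψ) (g χ))

_≟ᵀ_ : DecidableEquality Tag
φ ≟ᵀ φ = yes refl
φ ≟ᵀ χ = no λ ()
φ ≟ᵀ ψ = no λ ()
χ ≟ᵀ φ = no λ ()
χ ≟ᵀ χ = yes refl
χ ≟ᵀ ψ = no λ ()
ψ ≟ᵀ φ = no λ ()
ψ ≟ᵀ χ = no λ ()
ψ ≟ᵀ ψ = yes refl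

_≟ᵂ_ : ∀ {n} → DecidableEquality (W n)
_≟ᵂ_ = ≡-dec _≟_ _≟ᵀ_

δ-self : ∀ {n} (u : Fin n) → δ u u ≡ true
δ-self u = dec-true (u ≟ u) refl

δ-injective : ∀ {n m} (f : Fin n → Fin m) → Injective _≡_ _≡_ f → ∀ a b → δ (f a) (f b) ≡ δ a b
δ-injective f f-inj a b with a ≟ b
... | yes refl = δ-self (f a)
... | no a≢b = dec-false (f a ≟ f b) (a≢b ∘ f-inj)

toggleLoop-adj : ∀ {n} (G : LoopedSimpleGraph n) v u w →
  adj (toggleLoop G v) u w ≡ adj G u w xor (δ u v ∧ δ w v)
toggleLoop-adj G v u w = if-xor (δ u v ∧ δ w v) (adj G u w)
  where
  if-xor : ∀ c a → (if c then a xor true else a) ≡ a xor c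
  if-xor true a = refl
  if-xor false a = sym (xor-identityʳ a)

toggleLoop-adj-≢ : ∀ {n} (G : LoopedSimpleGraph n) {v w} u → ¬ w ≡ v →
  adj (toggleLoop G v) u w ≡ adj G u w
toggleLoop-adj-≢ G {v} {w} u w≢v = begin
  adj (toggleLoop G v) u w       ≡⟨ toggleLoop-adj G v u w ⟩
  adj G u w xor (δ u v ∧ δ w v)  ≡⟨ cong (λ b → adj G u w xor (δ u v ∧ b)) (dec-false (w ≟ v) w≢v) ⟩
  adj G u w xor (δ u v ∧ false)  ≡⟨ cong (adj G u w xor_) (∧-zeroʳ (δ u v)) ⟩
  adj G u w xor false            ≡⟨ xor-identityʳ (adj G u w) ⟩
  adj G u w                      ∎
  where open ≡-Reasoning

toggleLoop-adj-self : ∀ {n} (G : LoopedSimpleGraph n) v u →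
  adj (toggleLoop G v) u v ≡ δ u v xor adj G u v
toggleLoop-adj-self G v u = begin
  adj (toggleLoop G v) u v       ≡⟨ toggleLoop-adj G v u v ⟩
  adj G u v xor (δ u v ∧ δ v v)  ≡⟨ cong (λ b → adj G u v xor (δ u v ∧ b)) (δ-self v) ⟩
  adj G u v xor (δ u v ∧ true)   ≡⟨ cong (adj G u v xor_) (∧-identityʳ (δ u v)) ⟩
  adj G u v xor δ u v            ≡⟨ xor-comm (adj G u v) (δ u v) ⟩
  δ u v xor adj G u v            ∎
  where open ≡-Reasoning

column-toggleLoop : ∀ {n} (G : LoopedSimpleGraph n) v w ι u →
  column (toggleLoop G v) (w , ι) u ≡ column G (w , fSwapAt v w ι) u
column-toggleLoop G v w ι u with w ≟ v
column-toggleLoop G v w  φ u | no w≢v   = refl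
column-toggleLoop G v w  χ u | no w≢v   = toggleLoop-adj-≢ G u w≢v
column-toggleLoop G v w  ψ u | no w≢v   = cong (δ u w xor_) (toggleLoop-adj-≢ G u w≢v)
column-toggleLoop G v .v φ u | yes refl = refl
column-toggleLoop G v .v χ u | yes refl = toggleLoop-adj-self G v u
column-toggleLoop G v .v ψ u | yes refl =
  trans (cong (δ u v xor_) (toggleLoop-adj-self G v u)) (xor-cancelˡ (δ u v) (adj G u v))

IsGraphIso⇒column : ∀ {n m} {H : LoopedSimpleGraph n} {G : LoopedSimpleGraph m} (σ : Fin n ↔ Fin m) →
  IsGraphIso H G σ → ∀ w ι u → column G (to σ w , ι) (to σ u) ≡ column H (w , ι) u
IsGraphIso⇒column σ iso w φ u = δ-injective (to σ) (Injection.injective (↔⇒↣ σ)) u w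
IsGraphIso⇒column σ iso w χ u = iso u w
IsGraphIso⇒column σ iso w ψ u = cong₂ _xor_ (δ-injective (to σ) (Injection.injective (↔⇒↣ σ)) u w) (iso u w)

IsGraphIso-toggleLoop⇔ : ∀ {n m} (G₁ : LoopedSimpleGraph n) (G₂ : LoopedSimpleGraph m) v (σ : Fin n ↔ Fin m) →
  IsGraphIso (toggleLoop G₁ v) G₂ σ ⇔
  (∀ w ι u → column G₂ (to σ w , fSwapAt v w ι) (to σ u) ≡ column G₁ (w , ι) u)
IsGraphIso-toggleLoop⇔ G₁ G₂ v σ = mk⇔ swapped-columns graph-iso
  where
  swapped-columns : IsGraphIso (toggleLoop G₁ v) G₂ σ →
    ∀ w ι u → column G₂ (to σ w , fSwapAt v w ι) (to σ u) ≡ column G₁ (w , ι) u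
  swapped-columns iso w ι u = begin
    column G₂ (to σ w , fSwapAt v w ι) (to σ u)
      ≡⟨ IsGraphIso⇒column σ iso w (fSwapAt v w ι) u ⟩
    column (toggleLoop G₁ v) (w , fSwapAt v w ι) u
      ≡⟨ column-toggleLoop G₁ v w (fSwapAt v w ι) u ⟩
    column G₁ (w , fSwapAt v w (fSwapAt v w ι)) u
      ≡⟨ cong (λ ι′ → column G₁ (w , ι′) u) (swapIf-involutive (does (w ≟ v)) ι) ⟩
    column G₁ (w , ι) u
      ∎
    where open ≡-Reasoning

  graph-iso : (∀ w ι u → column G₂ (to σ w , fSwapAt v w ι) (to σ u) ≡ column G₁ (w , ι) u) →
    IsGraphIso (toggleLoop G₁ v) G₂ σ
  graph-iso cols u w = begin
    column G₂ (to σ w , χ) (to σ u)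
      ≡⟨ cong (λ ι → column G₂ (to σ w , ι) (to σ u)) (swapIf-involutive (does (w ≟ v)) χ) ⟨
    column G₂ (to σ w , fSwapAt v w (fSwapAt v w χ)) (to σ u)
      ≡⟨ cols w (fSwapAt v w χ) u ⟩
    column G₁ (w , fSwapAt v w χ) u
      ≡⟨ column-toggleLoop G₁ v w χ u ⟨
    column (toggleLoop G₁ v) (w , χ) u
      ∎
    where open ≡-Reasoning

PreservesColumns : ∀ {n m} → LoopedSimpleGraph n → LoopedSimpleGraph m → (W n → W m) → (Fin n → Fin m) → Set
PreservesColumns G₁ G₂ β s = ∀ x u → column G₂ (β x) (s u) ≡ column G₁ x u

⊕Tag-cong : {g h : Tag → Bool} → (∀ ι → g ι ≡ h ι) → ⊕Tag g ≡ ⊕Tag h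
⊕Tag-cong g≗h = cong₂ _xor_ (g≗h φ) (cong₂ _xor_ (g≗h χ) (g≗h ψ))

lincomb-cong : ∀ {n} (G : LoopedSimpleGraph n) {c c′ : W n → Bool} → (∀ x → c x ≡ c′ x) →
  ∀ u → lincomb G c u ≡ lincomb G c′ u
lincomb-cong G c≗c′ u = ⊕Σ-cong λ w → ⊕Tag-cong λ ι → cong (_∧ column G (w , ι) u) (c≗c′ (w , ι))

Independent-mono : ∀ {n} {G : LoopedSimpleGraph n} {S S′ : W n → Bool} →
  Independent G S → (∀ x → S′ x ≡ true → S x ≡ true) → Independent G S′
Independent-mono ind S′⊆S c c⊆S′ c-null = ind c (λ x → S′⊆S x ∘ c⊆S′ x) c-null

Independent-cong : ∀ {n} {G : LoopedSimpleGraph n} {S S′ : W n → Bool} →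
  (∀ x → S x ≡ S′ x) → Independent G S → Independent G S′
Independent-cong {G = G} S≗S′ ind = Independent-mono {G = G} ind (λ x → trans (S≗S′ x))

IsMatroidIso-of-lincomb : ∀ {n m} (G₁ : LoopedSimpleGraph n) (G₂ : LoopedSimpleGraph m)
  (β : W n ↔ W m) (σ : Fin n ↔ Fin m) →
  (∀ c u → lincomb G₂ c (to σ u) ≡ lincomb G₁ (c ∘ to β) u) → IsMatroidIso G₁ G₂ β
IsMatroidIso-of-lincomb G₁ G₂ β σ lin S = mk⇔ forward backward
  where
  open ≡-Reasoning

  forward : Independent G₁ S → Independent G₂ (S ∘ from β)
  forward ind c c⊆S∘β⁻¹ c-null y = begin
    c y                 ≡⟨ cong c (strictlyInverseˡ β y) ⟨
    c (to β (from β y)) ≡⟨ ind (c ∘ to β) c∘β⊆S (λ u → trans (sym (lin c u)) (c-null (to σ u))) (from β y) ⟩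
    false               ∎
    where
    c∘β⊆S : ∀ x → c (to β x) ≡ true → S x ≡ true
    c∘β⊆S x e = subst (λ x′ → S x′ ≡ true) (strictlyInverseʳ β x) (c⊆S∘β⁻¹ (to β x) e)

  backward : Independent G₂ (S ∘ from β) → Independent G₁ S
  backward ind c c⊆S c-null x = begin
    c x                 ≡⟨ cong c (strictlyInverseʳ β x) ⟨
    c (from β (to β x)) ≡⟨ ind (c ∘ from β) (c⊆S ∘ from β) null (to β x) ⟩
    false               ∎
    where
    null : ∀ u′ → lincomb G₂ (c ∘ from β) u′ ≡ false
    null u′ = begin
      lincomb G₂ (c ∘ from β) u′
        ≡⟨ cong (lincomb G₂ (c ∘ from β)) (strictlyInverseˡ σ u′) ⟨
      lincomb G₂ (c ∘ from β) (to σ (from σ u′))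
        ≡⟨ lin (c ∘ from β) (from σ u′) ⟩
      lincomb G₁ (c ∘ from β ∘ to β) (from σ u′)
        ≡⟨ lincomb-cong G₁ (cong c ∘ strictlyInverseʳ β) (from σ u′) ⟩
      lincomb G₁ c (from σ u′)
        ≡⟨ c-null (from σ u′) ⟩
      false
        ∎

liftCells : ∀ {n m} → Fin n ↔ Fin m → (Fin n → Bool) → W n ↔ W m
liftCells σ b = mk↔ₛ′ (λ (w , ι) → to σ w , swapIf (b w) ι) (λ (y , ι) → from σ y , swapIf (b (from σ y)) ι)
  (λ (y , ι) → cong₂ _,_ (strictlyInverseˡ σ y) (swapIf-involutive (b (from σ y)) ι))
  (λ (w , ι) → trans (cong (λ w′ → w′ , swapIf (b w′) (swapIf (b w) ι)) (strictlyInverseʳ σ w))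
                     (cong (w ,_) (swapIf-involutive (b w) ι)))

lincomb-liftCells : ∀ {n m} (G₁ : LoopedSimpleGraph n) (G₂ : LoopedSimpleGraph m)
  (σ : Fin n ↔ Fin m) (b : Fin n → Bool) → PreservesColumns G₁ G₂ (to (liftCells σ b)) (to σ) →
  ∀ c u → lincomb G₂ c (to σ u) ≡ lincomb G₁ (c ∘ to (liftCells σ b)) u
lincomb-liftCells G₁ G₂ σ b cols c u = begin
  lincomb G₂ c (to σ u)
    ≡⟨ ⊕Σ-permute σ _ ⟩
  ⊕Σ (λ w → ⊕Tag λ ι → c (to σ w , ι) ∧ column G₂ (to σ w , ι) (to σ u))
    ≡⟨ ⊕Σ-cong (λ w → ⊕Tag-swapIf (b w) (λ ι → c (to σ w , ι) ∧ column G₂ (to σ w , ι) (to σ u))) ⟨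
  ⊕Σ (λ w → ⊕Tag λ ι → c (β (w , ι)) ∧ column G₂ (β (w , ι)) (to σ u))
    ≡⟨ ⊕Σ-cong (λ w → ⊕Tag-cong λ ι → cong (c (β (w , ι)) ∧_) (cols (w , ι) u)) ⟩
  lincomb G₁ (c ∘ β) u
    ∎
  where
  open ≡-Reasoning
  β = to (liftCells σ b)

NonPhi : ∀ {n} → W n → Set
NonPhi x = ¬ proj₂ x ≡ φ

basisWith : ∀ {n} → (Fin n → Bool) → W n → W n → Bool
basisWith T y (u , φ) = T u
basisWith T y x = does (x ≟ᵂ y)

basisWith-nonPhi : ∀ {n} (T : Fin n → Bool) y {z} → NonPhi z → basisWith T y z ≡ does (z ≟ᵂ y)
basisWith-nonPhi T y {u , φ} nφ = ⊥-elim (nφ refl)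
basisWith-nonPhi T y {u , χ} nφ = refl
basisWith-nonPhi T y {u , ψ} nφ = refl

basisWith-self : ∀ {n} (T : Fin n → Bool) {y} → NonPhi y → basisWith T y y ≡ true
basisWith-self T {y} nφ = trans (basisWith-nonPhi T y nφ) (dec-true (y ≟ᵂ y) refl)

basisWith-other : ∀ {n} (T : Fin n → Bool) y {z} → NonPhi z → ¬ z ≡ y → basisWith T y z ≡ false
basisWith-other T y {z} nφ z≢y = trans (basisWith-nonPhi T y nφ) (dec-false (z ≟ᵂ y) z≢y)

basisWith-member : ∀ {n} (T : Fin n → Bool) y {z} → NonPhi z → basisWith T y z ≡ true → z ≡ y
basisWith-member T y {z} nφ e with z ≟ᵂ y | basisWith-other T y nφ
... | yes z≡y | _     = z≡y
... | no z≢y  | other = ⊥-elim (true≢false (trans (sym e) (other z≢y)))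

lincomb-split-φ : ∀ {n} (G : LoopedSimpleGraph n) c u →
  lincomb G c u ≡ c (u , φ) xor ⊕Σ (λ w → (c (w , χ) ∧ column G (w , χ) u) xor (c (w , ψ) ∧ column G (w , ψ) u))
lincomb-split-φ G c u = trans (⊕Σ-xor (λ w → c (w , φ) ∧ δ u w) rest) (cong (_xor ⊕Σ rest) φ-part)
  where
  open ≡-Reasoning
  rest = λ w → (c (w , χ) ∧ column G (w , χ) u) xor (c (w , ψ) ∧ column G (w , ψ) u)
  φ-part : ⊕Σ (λ w → c (w , φ) ∧ δ u w) ≡ c (u , φ)
  φ-part = begin
    ⊕Σ (λ w → c (w , φ) ∧ δ u w) ≡⟨ ⊕Σ-single _ u off-diagonal ⟩
    c (u , φ) ∧ δ u u            ≡⟨ cong (c (u , φ) ∧_) (δ-self u) ⟩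
    c (u , φ) ∧ true             ≡⟨ ∧-identityʳ (c (u , φ)) ⟩
    c (u , φ)                    ∎
    where
    off-diagonal : ∀ w → ¬ w ≡ u → c (w , φ) ∧ δ u w ≡ false
    off-diagonal w w≢u = trans (cong (c (w , φ) ∧_) (dec-false (u ≟ w) (w≢u ∘ sym))) (∧-zeroʳ (c (w , φ)))

lincomb-supported : ∀ {n} (G : LoopedSimpleGraph n) c y → NonPhi y →
  (∀ z → NonPhi z → ¬ z ≡ y → c z ≡ false) → ∀ u → lincomb G c u ≡ c (u , φ) xor (c y ∧ column G y u)
lincomb-supported G c (w₀ , ι₀) nφ off u =
  trans (lincomb-split-φ G c u) (cong (c (u , φ) xor_) (trans (⊕Σ-single _ w₀ elsewhere) (at-w₀ ι₀ nφ off)))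
  where
  elsewhere : ∀ w → ¬ w ≡ w₀ →
    (c (w , χ) ∧ column G (w , χ) u) xor (c (w , ψ) ∧ column G (w , ψ) u) ≡ false
  elsewhere w w≢w₀
    rewrite off (w , χ) (λ ()) (w≢w₀ ∘ cong proj₁) | off (w , ψ) (λ ()) (w≢w₀ ∘ cong proj₁) = refl
  at-w₀ : ∀ ι₀ → ¬ ι₀ ≡ φ → (∀ z → NonPhi z → ¬ z ≡ (w₀ , ι₀) → c z ≡ false) →
    (c (w₀ , χ) ∧ column G (w₀ , χ) u) xor (c (w₀ , ψ) ∧ column G (w₀ , ψ) u)
      ≡ c (w₀ , ι₀) ∧ column G (w₀ , ι₀) u
  at-w₀ φ nφ off = ⊥-elim (nφ refl)
  at-w₀ χ nφ off rewrite off (w₀ , ψ) (λ ()) (λ ()) = xor-identityʳ _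
  at-w₀ ψ nφ off rewrite off (w₀ , χ) (λ ()) (λ ()) = refl

outside-support : ∀ {A : Set} {c S : A → Bool} →
  (∀ x → c x ≡ true → S x ≡ true) → ∀ x → S x ≡ false → c x ≡ false
outside-support {c = c} c⊆S x Sx≡false with c x in cx
... | false = refl
... | true with () ← trans (sym (c⊆S x cx)) Sx≡false

basisWith-dependent : ∀ {n} (G : LoopedSimpleGraph n) {y} → NonPhi y →
  ¬ Independent G (basisWith (column G y) y)
basisWith-dependent G {y} nφ ind =
  true≢false (trans (sym (basisWith-self (column G y) nφ)) (ind c (λ _ e → e) null y))
  where
  c = basisWith (column G y) y
  null : ∀ u → lincomb G c u ≡ false
  null u = begin
    lincomb G c u
      ≡⟨ lincomb-supported G c y nφ (λ z → basisWith-other (column G y) y) u ⟩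
    column G y u xor (c y ∧ column G y u)
      ≡⟨ cong (λ b → column G y u xor (b ∧ column G y u)) (basisWith-self (column G y) nφ) ⟩
    column G y u xor column G y u
      ≡⟨ xor-same (column G y u) ⟩
    false
      ∎
    where open ≡-Reasoning

basisWith-independent : ∀ {n} (G : LoopedSimpleGraph n) {y} (T : Fin n → Bool) {u} → NonPhi y →
  column G y u ≡ true → T u ≡ false → Independent G (basisWith T y)
basisWith-independent G {y} T {u} nφ yᵤ≡true Tᵤ≡false c c⊆ null = vanishes
  where
  off : ∀ z → NonPhi z → ¬ z ≡ y → c z ≡ false
  off z nφz z≢y = outside-support c⊆ z (basisWith-other T y nφz z≢y)
  split = lincomb-supported G c y nφ off
  cy≡false : c y ≡ false
  cy≡false = begin
    c y                                   ≡⟨ ∧-identityʳ (c y) ⟨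
    c y ∧ true                            ≡⟨ cong (c y ∧_) yᵤ≡true ⟨
    c y ∧ column G y u                    ≡⟨ cong (_xor (c y ∧ column G y u)) (outside-support c⊆ (u , φ) Tᵤ≡false) ⟨
    c (u , φ) xor (c y ∧ column G y u)    ≡⟨ split u ⟨
    lincomb G c u                         ≡⟨ null u ⟩
    false                                 ∎
    where open ≡-Reasoning
  cφ≡false : ∀ w → c (w , φ) ≡ false
  cφ≡false w = begin
    c (w , φ)                              ≡⟨ xor-identityʳ (c (w , φ)) ⟨
    c (w , φ) xor false                    ≡⟨ cong (λ b → c (w , φ) xor (b ∧ column G y w)) cy≡false ⟨
    c (w , φ) xor (c y ∧ column G y w)     ≡⟨ split w ⟨
    lincomb G c w                          ≡⟨ null w ⟩
    false                                  ∎
    where open ≡-Reasoning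
  vanishes-nonPhi : ∀ z → NonPhi z → c z ≡ false
  vanishes-nonPhi z nφz with z ≟ᵂ y
  ... | yes refl = cy≡false
  ... | no z≢y = off z nφz z≢y
  vanishes : ∀ x → c x ≡ false
  vanishes (w , φ) = cφ≡false w
  vanishes (w , χ) = vanishes-nonPhi (w , χ) λ ()
  vanishes (w , ψ) = vanishes-nonPhi (w , ψ) λ ()

IsMatroidIso-sym : ∀ {n m} {G₁ : LoopedSimpleGraph n} {G₂ : LoopedSimpleGraph m} {β : W n ↔ W m} →
  IsMatroidIso G₁ G₂ β → IsMatroidIso G₂ G₁ (↔-sym β)
IsMatroidIso-sym {G₁ = G₁} {G₂} {β} iso S = mk⇔
  (Equivalence.from (iso (S ∘ to β)) ∘ Independent-cong {G = G₂} (λ y → cong S (sym (strictlyInverseˡ β y))))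
  (Independent-cong {G = G₂} (λ y → cong S (strictlyInverseˡ β y)) ∘ Equivalence.to (iso (S ∘ to β)))

from-fixes-φ : ∀ {n m} (β : W n ↔ W m) (σ : Fin n ↔ Fin m) → (∀ w → to β (w , φ) ≡ (to σ w , φ)) →
  ∀ y → from β (y , φ) ≡ (from σ y , φ)
from-fixes-φ β σ fixes-φ y = begin
  from β (y , φ)                    ≡⟨ cong (λ y′ → from β (y′ , φ)) (strictlyInverseˡ σ y) ⟨
  from β (to σ (from σ y) , φ)      ≡⟨ cong (from β) (fixes-φ (from σ y)) ⟨
  from β (to β (from σ y , φ))      ≡⟨ strictlyInverseʳ β (from σ y , φ) ⟩
  (from σ y , φ)                    ∎
  where open ≡-Reasoning

nonPhi-preserved : ∀ {n m} (β : W n ↔ W m) (σ : Fin n ↔ Fin m) → (∀ w → to β (w , φ) ≡ (to σ w , φ)) →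
  ∀ {x} → NonPhi x → NonPhi (to β x)
nonPhi-preserved β σ fixes-φ {x} nφ βx-φ = nφ (cong proj₂ (begin
  x                                 ≡⟨ strictlyInverseʳ β x ⟨
  from β (to β x)                   ≡⟨ cong (λ ι → from β (proj₁ (to β x) , ι)) βx-φ ⟩
  from β (proj₁ (to β x) , φ)       ≡⟨ from-fixes-φ β σ fixes-φ (proj₁ (to β x)) ⟩
  (from σ (proj₁ (to β x)) , φ)     ∎))
  where open ≡-Reasoning

module _ {n m} (G₁ : LoopedSimpleGraph n) (G₂ : LoopedSimpleGraph m) (β : W n ↔ W m)
  (iso : IsMatroidIso G₁ G₂ β) (σ : Fin n ↔ Fin m) (fixes-φ : ∀ w → to β (w , φ) ≡ (to σ w , φ)) where

  -- Coordinate u of a non-basis column x is 1 iff u_φ lies in the fundamental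
  -- circuit of x, which β carries to the fundamental circuit of β x.
  column-true-preserved-nonPhi : ∀ x → NonPhi x → ∀ u → column G₁ x u ≡ true → column G₂ (to β x) (to σ u) ≡ true
  column-true-preserved-nonPhi x nφ u xᵤ≡true with column G₂ (to β x) (to σ u) in yᵤ
  ... | true = refl
  ... | false = ⊥-elim (basisWith-dependent G₂ (nonPhi-preserved β σ fixes-φ nφ)
                                             (Independent-mono {G = G₂} transported circuit⊆))
    where
    y = to β x
    T : Fin n → Bool
    T u′ = column G₂ y (to σ u′)
    transported : Independent G₂ (basisWith T x ∘ from β)
    transported = Equivalence.to (iso (basisWith T x)) (basisWith-independent G₁ T nφ xᵤ≡true yᵤ)
    in-image : ∀ z → NonPhi z → basisWith (column G₂ y) y z ≡ true → basisWith T x (from β z) ≡ true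
    in-image z nφz e rewrite basisWith-member (column G₂ y) y nφz e | strictlyInverseʳ β x = basisWith-self T nφ
    circuit⊆ : ∀ z → basisWith (column G₂ y) y z ≡ true → basisWith T x (from β z) ≡ true
    circuit⊆ (u′ , φ) e rewrite from-fixes-φ β σ fixes-φ u′ = trans (cong (column G₂ y) (strictlyInverseˡ σ u′)) e
    circuit⊆ (u′ , χ) = in-image (u′ , χ) λ ()
    circuit⊆ (u′ , ψ) = in-image (u′ , ψ) λ ()

  column-true-preserved : ∀ x u → column G₁ x u ≡ true → column G₂ (to β x) (to σ u) ≡ true
  column-true-preserved (w , φ) u δuw rewrite fixes-φ w =
    trans (δ-injective (to σ) (Injection.injective (↔⇒↣ σ)) u w) δuw
  column-true-preserved (w , χ) = column-true-preserved-nonPhi (w , χ) λ ()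
  column-true-preserved (w , ψ) = column-true-preserved-nonPhi (w , ψ) λ ()

IsMatroidIso⇒PreservesColumns : ∀ {n m} (G₁ : LoopedSimpleGraph n) (G₂ : LoopedSimpleGraph m) (β : W n ↔ W m) →
  IsMatroidIso G₁ G₂ β → (σ : Fin n ↔ Fin m) → (∀ w → to β (w , φ) ≡ (to σ w , φ)) →
  PreservesColumns G₁ G₂ (to β) (to σ)
IsMatroidIso⇒PreservesColumns G₁ G₂ β iso σ fixes-φ x u =
  ⇔→≡ {z = true} (mk⇔ reflected (column-true-preserved G₁ G₂ β iso σ fixes-φ x u))
  where
  reflected : column G₂ (to β x) (to σ u) ≡ true → column G₁ x u ≡ true
  reflected e = subst₂ (λ x′ u′ → column G₁ x′ u′ ≡ true) (strictlyInverseʳ β x) (strictlyInverseʳ σ u)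
    (column-true-preserved G₂ G₁ (↔-sym β) (IsMatroidIso-sym {G₁ = G₁} {G₂} {β} iso) (↔-sym σ)
                           (from-fixes-φ β σ fixes-φ) (to β x) (to σ u) e)

cellBijection : ∀ {n m} (β : W n ↔ W m) (s : Fin n → Fin m) (f : Fin n → Tag → Tag) →
  InducesCompatible β s f → (∀ w → f w φ ≡ φ) → Fin n ↔ Fin m
cellBijection β s f compatible f-φ = mk↔ₛ′ s (λ y → proj₁ (from β (y , φ))) s∘s⁻¹ s⁻¹∘s
  where
  s∘s⁻¹ : ∀ y → s (proj₁ (from β (y , φ))) ≡ y
  s∘s⁻¹ y = cong proj₁ (trans (sym (compatible (proj₁ x) (proj₂ x))) (strictlyInverseˡ β (y , φ)))
    where x = from β (y , φ)
  s⁻¹∘s : ∀ w → proj₁ (from β (s w , φ)) ≡ w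
  s⁻¹∘s w = cong proj₁ (trans (cong (λ ι → from β (s w , ι)) (sym (f-φ w)))
                              (trans (cong (from β) (sym (compatible w φ))) (strictlyInverseʳ β (w , φ))))

toggleLoop-iso⇒IsMatroidIso : ∀ {n m} (G₁ : LoopedSimpleGraph n) (G₂ : LoopedSimpleGraph m) v (σ : Fin n ↔ Fin m) →
  IsGraphIso (toggleLoop G₁ v) G₂ σ → IsMatroidIso G₁ G₂ (liftCells σ (λ w → does (w ≟ v)))
toggleLoop-iso⇒IsMatroidIso G₁ G₂ v σ iso =
  IsMatroidIso-of-lincomb G₁ G₂ (liftCells σ isV) σ (lincomb-liftCells G₁ G₂ σ isV columns)
  where
  isV = λ w → does (w ≟ v)
  columns : PreservesColumns G₁ G₂ (to (liftCells σ isV)) (to σ)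
  columns (w , ι) = Equivalence.to (IsGraphIso-toggleLoop⇔ G₁ G₂ v σ) iso w ι

compatible-IsMatroidIso⇒toggleLoop-iso : ∀ {n m} (G₁ : LoopedSimpleGraph n) (G₂ : LoopedSimpleGraph m) v
  (β : W n ↔ W m) (s : Fin n → Fin m) (compatible : InducesCompatible β s (fSwapAt v)) → IsMatroidIso G₁ G₂ β →
  IsGraphIso (toggleLoop G₁ v) G₂ (cellBijection β s (fSwapAt v) compatible (fSwapAt-φ v))
compatible-IsMatroidIso⇒toggleLoop-iso G₁ G₂ v β s compatible iso =
  Equivalence.from (IsGraphIso-toggleLoop⇔ G₁ G₂ v σ) λ w ι u →
    trans (cong (λ x → column G₂ x (s u)) (sym (compatible w ι))) (columns (w , ι) u)
  where
  σ = cellBijection β s (fSwapAt v) compatible (fSwapAt-φ v)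
  fixes-φ : ∀ w → to β (w , φ) ≡ (s w , φ)
  fixes-φ w = trans (compatible w φ) (cong (s w ,_) (fSwapAt-φ v w))
  columns = IsMatroidIso⇒PreservesColumns G₁ G₂ β iso σ fixes-φ

theorem8 : {n m : ℕ} (G₁ : LoopedSimpleGraph n) (G₂ : LoopedSimpleGraph m) (v : Fin n) →
    (Σ (Fin n ↔ Fin m) λ σ → IsGraphIso (toggleLoop G₁ v) G₂ σ)
    ⇔ (Σ (W n ↔ W m) λ β → IsMatroidIso G₁ G₂ β ×
         (Σ (Fin n → Fin m) λ σ → InducesCompatible β σ (fSwapAt v)))
theorem8 G₁ G₂ v = mk⇔
  (λ (σ , iso) →
    liftCells σ (λ w → does (w ≟ v)) , toggleLoop-iso⇒IsMatroidIso G₁ G₂ v σ iso , to σ , λ w ι → refl)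
  (λ (β , iso , s , compatible) →
    cellBijection β s (fSwapAt v) compatible (fSwapAt-φ v) ,
    compatible-IsMatroidIso⇒toggleLoop-iso G₁ G₂ v β s compatible iso)
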